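{- Let $x$ be a number with $x^2-4x\neq0$ and let $\lambda=\frac12\left(x-2+\sqrt{x^2-4x}\right)$. Then for every nonnegative integer $m$, \[\overline{G}^{1,1}_{2m}(x)=\frac{\lambda^{2m+1}-1}{\lambda^m(\lambda-1)},\qquad \overline{G}^{1,1}_{2m+1}(x)=\frac{\lambda^{2m+2}-1}{\lambda^m(\lambda^2-1)},\] \[\overline{G}^{2,1}_{2m}(x)=\frac{\lambda^{2m}+1}{\lambda^m},\qquad \overline{G}^{2,1}_{2m+1}(x)=\frac{\lambda^{2m+1}+1}{\lambda^m(\lambda+1)}.\]
   Context: For positive reals $\alpha,\beta$, the sign-alternating Gibonacci polynomials are defined by $\overline{G}^{\alpha,\beta}_0(x)=\alpha$, $\overline{G}^{\alpha,\beta}_1(x)=\beta$, and $\overline{G}^{\alpha,\beta}_k(x)=x^{(k-1)\bmod 2}\,\overline{G}^{\alpha,\beta}_{k-1}(x)-\overline{G}^{\alpha,\beta}_{k-2}(x)$ for $k\ge2$. The case $(\alpha,\beta)=(1,1)$ gives the sign-alternating Fibonacci polynomials and $(\alpha,\beta)=(2,1)$ the sign-alternating Lucas polynomials. -}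

module Defs where

open import Level using (Level; _⊔_) renaming (suc to lsuc)
open import Data.Nat using (ℕ; zero; suc; _%_)
open import Relation.Nullary using (¬_)
open import Algebra.Bundles using (CommutativeRing)

record Field (c ℓ : Level) : Set (lsuc (c ⊔ ℓ)) where
  field
    commutativeRing : CommutativeRing c ℓ
  open CommutativeRing commutativeRing public
  field
    _⁻¹       : Carrier → Carrier
    1≉0       : ¬ (1# ≈ 0#)
    *-inverse : ∀ a → ¬ (a ≈ 0#) → a * (a ⁻¹) ≈ 1#

  infixl 7 _/_
  _/_ : Carrier → Carrier → Carrier
  a / b = a * (b ⁻¹)

  infixr 8 _^_
  _^_ : Carrier → ℕ → Carrier
  a ^ zero  = 1#
  a ^ suc n = a * (a ^ n)

  Gbar : Carrier → Carrier → Carrier → ℕ → Carrier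
  Gbar α β x zero          = α
  Gbar α β x (suc zero)    = β
  Gbar α β x (suc (suc k)) =
    (x ^ (suc k % 2)) * Gbar α β x (suc k) - Gbar α β x k

  two : Carrier
  two = 1# + 1#

  four : Carrier
  four = two + two

-- Put λ = (x − 2 + s)/2 and μ = (x − 2 − s)/2, so that λμ = 1, x = λ + μ + 2 and
-- x² − 4x = (λ − μ)². One step of the recurrence, reduced modulo λμ = 1, shows
-- that for every sign-alternating Gibonacci sequence and all d, a, b with
-- d α = (λ + 1)(a + b) and d β = aλ + b,
--   d G₂ₘ = (λ + 1)(aλᵐ + bμᵐ)   and   d G₂ₘ₊₁ = aλᵐ⁺¹ + bμᵐ.
-- Fibonacci is (d, a, b) = (λ² − 1, λ, −1) and Lucas is (λ + 1, 1, 1); multiplying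
-- by λᵐ and using λᵐμᵐ = 1 gives the four closed forms. The denominators do not
-- vanish: λ² = 1 would force λ = μ, i.e. x² − 4x = 0.
module Submission where

open import Algebra.Bundles using (CommutativeRing; RawRing)
import Algebra.Solver.Ring.AlmostCommutativeRing as ACR
open import Data.Integer as ℤ using (ℤ; +_; -[1+_])
import Data.Integer.Properties as ℤ
open import Data.Maybe using (Maybe; just; nothing)
import Data.Nat as N
open N using (ℕ; zero; suc)
import Data.Nat.Properties as N
open import Data.Sign as Sign using (Sign)
open import Defs
open import Level using (Level)
open import Relation.Binary.PropositionalEquality as ≡ using (_≡_)
open import Relation.Nullary using (¬_; yes; no)

-- The ring solver normalises over a coefficient ring with decidable equality that
-- maps into R; over ℤ, cancellations such as y − y = 0 are detected.
module IntegerCoefficients {c ℓ} (R : CommutativeRing c ℓ) where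
  open CommutativeRing R
  open import Algebra.Properties.Ring ring
  open import Algebra.Properties.Semiring.Mult.TCOptimised semiring
  open import Relation.Binary.Reasoning.Setoid setoid

  fromℤ : ℤ → Carrier
  fromℤ (+ n)    = n × 1#
  fromℤ -[1+ n ] = - (suc n × 1#)

  fromSign : Sign → Carrier
  fromSign Sign.+ = 1#
  fromSign Sign.- = - 1#

  fromℤ-⊖ : ∀ m n → fromℤ (m ℤ.⊖ n) ≈ m × 1# - n × 1#
  fromℤ-⊖ m zero = begin
    m × 1#       ≈⟨ +-identityʳ (m × 1#) ⟨
    m × 1# + 0#  ≈⟨ +-congˡ -0#≈0# ⟨
    m × 1# - 0#  ∎
  fromℤ-⊖ zero (suc n) = sym (+-identityˡ _)
  fromℤ-⊖ (suc m) (suc n) = begin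
    fromℤ (suc m ℤ.⊖ suc n)    ≡⟨ ≡.cong fromℤ (ℤ.[1+m]⊖[1+n]≡m⊖n m n) ⟩
    fromℤ (m ℤ.⊖ n)            ≈⟨ fromℤ-⊖ m n ⟩
    a - b                      ≈⟨ shift ⟩
    (1# + a) - (1# + b)        ≈⟨ +-cong (1+× m 1#) (-‿cong (1+× n 1#)) ⟨
    suc m × 1# - suc n × 1#    ∎
    where
    a = m × 1#
    b = n × 1#
    shift : a - b ≈ (1# + a) - (1# + b)
    shift = begin
      a - b                    ≈⟨ +-identityˡ _ ⟨
      0# + (a - b)             ≈⟨ +-congʳ (-‿inverseʳ 1#) ⟨
      (1# - 1#) + (a - b)      ≈⟨ +-assoc _ _ _ ⟩
      1# + (- 1# + (a - b))    ≈⟨ +-congˡ (+-comm _ _) ⟩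
      1# + ((a - b) - 1#)      ≈⟨ +-congˡ (+-assoc _ _ _) ⟩
      1# + (a + (- b - 1#))    ≈⟨ +-assoc _ _ _ ⟨
      (1# + a) + (- b - 1#)    ≈⟨ +-congˡ (+-comm _ _) ⟩
      (1# + a) + (- 1# + - b)  ≈⟨ +-congˡ (-‿+-comm 1# b) ⟩
      (1# + a) - (1# + b)      ∎

  fromℤ-sign-abs : ∀ i → fromℤ i ≈ fromSign (ℤ.sign i) * (ℤ.∣ i ∣ × 1#)
  fromℤ-sign-abs (+ n)    = sym (*-identityˡ _)
  fromℤ-sign-abs -[1+ n ] = begin
    - (suc n × 1#)          ≈⟨ -‿cong (*-identityˡ _) ⟨
    - (1# * (suc n × 1#))   ≈⟨ -‿distribˡ-* _ _ ⟩
    - 1# * (suc n × 1#)     ∎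

  fromℤ-◃ : ∀ s n → fromℤ (s ℤ.◃ n) ≈ fromSign s * (n × 1#)
  fromℤ-◃ s       zero    = sym (zeroʳ _)
  fromℤ-◃ Sign.+ (suc n) = sym (*-identityˡ _)
  fromℤ-◃ Sign.- (suc n) = fromℤ-sign-abs -[1+ n ]

  fromSign-* : ∀ s t → fromSign (s Sign.* t) ≈ fromSign s * fromSign t
  fromSign-* Sign.+ t      = sym (*-identityˡ _)
  fromSign-* Sign.- Sign.+ = sym (*-identityʳ _)
  fromSign-* Sign.- Sign.- = begin
    1#               ≈⟨ -‿involutive 1# ⟨
    - - 1#           ≈⟨ -‿cong (*-identityʳ _) ⟨
    - (- 1# * 1#)    ≈⟨ -‿distribʳ-* _ _ ⟩
    - 1# * - 1#      ∎

  fromℤ-+ : ∀ i j → fromℤ (i ℤ.+ j) ≈ fromℤ i + fromℤ j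
  fromℤ-+ (+ m)    (+ n)    = ×-homo-+ 1# m n
  fromℤ-+ (+ m)    -[1+ n ] = fromℤ-⊖ m (suc n)
  fromℤ-+ -[1+ m ] (+ n)    = trans (fromℤ-⊖ n (suc m)) (+-comm _ _)
  fromℤ-+ -[1+ m ] -[1+ n ] = begin
    - (suc (suc (m N.+ n)) × 1#)       ≡⟨ ≡.cong (λ k → - (k × 1#)) (≡.sym (N.+-suc (suc m) n)) ⟩
    - ((suc m N.+ suc n) × 1#)         ≈⟨ -‿cong (×-homo-+ 1# (suc m) (suc n)) ⟩
    - (suc m × 1# + suc n × 1#)        ≈⟨ -‿+-comm _ _ ⟨
    - (suc m × 1#) + - (suc n × 1#)    ∎

  fromℤ-* : ∀ i j → fromℤ (i ℤ.* j) ≈ fromℤ i * fromℤ j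
  fromℤ-* i j = begin
    fromℤ (ℤ.sign i Sign.* ℤ.sign j ℤ.◃ ℤ.∣ i ∣ N.* ℤ.∣ j ∣)
      ≈⟨ fromℤ-◃ (ℤ.sign i Sign.* ℤ.sign j) (ℤ.∣ i ∣ N.* ℤ.∣ j ∣) ⟩
    fromSign (ℤ.sign i Sign.* ℤ.sign j) * ((ℤ.∣ i ∣ N.* ℤ.∣ j ∣) × 1#)
      ≈⟨ *-cong (fromSign-* (ℤ.sign i) (ℤ.sign j)) (×1-homo-* ℤ.∣ i ∣ ℤ.∣ j ∣) ⟩
    (s * t) * (a * b)  ≈⟨ *-assoc _ _ _ ⟩
    s * (t * (a * b))  ≈⟨ *-congˡ (*-assoc _ _ _) ⟨
    s * ((t * a) * b)  ≈⟨ *-congˡ (*-congʳ (*-comm _ _)) ⟩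
    s * ((a * t) * b)  ≈⟨ *-congˡ (*-assoc _ _ _) ⟩
    s * (a * (t * b))  ≈⟨ *-assoc _ _ _ ⟨
    (s * a) * (t * b)  ≈⟨ *-cong (fromℤ-sign-abs i) (fromℤ-sign-abs j) ⟨
    fromℤ i * fromℤ j  ∎
    where
    s = fromSign (ℤ.sign i)
    t = fromSign (ℤ.sign j)
    a = ℤ.∣ i ∣ × 1#
    b = ℤ.∣ j ∣ × 1#

  fromℤ-neg : ∀ i → fromℤ (ℤ.- i) ≈ - fromℤ i
  fromℤ-neg (+ zero)  = sym -0#≈0#
  fromℤ-neg (+ suc n) = refl
  fromℤ-neg -[1+ n ]  = sym (-‿involutive _)

  ℤ-rawRing : RawRing _ _
  ℤ-rawRing = record
    { Carrier = ℤ ; _≈_ = _≡_ ; _+_ = ℤ._+_ ; _*_ = ℤ._*_ ; -_ = ℤ.-_ ; 0# = + 0 ; 1# = + 1 }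

  fromℤ-homomorphism : ℤ-rawRing ACR.-Raw-AlmostCommutative⟶ ACR.fromCommutativeRing R
  fromℤ-homomorphism = record
    { ⟦_⟧ = fromℤ ; +-homo = fromℤ-+ ; *-homo = fromℤ-* ; -‿homo = fromℤ-neg
    ; 0-homo = refl ; 1-homo = refl }

  fromℤ-≟ : ∀ i j → Maybe (fromℤ i ≈ fromℤ j)
  fromℤ-≟ i j with i ℤ.≟ j
  ... | yes ≡.refl = just refl
  ... | no _       = nothing

  open import Algebra.Solver.Ring ℤ-rawRing (ACR.fromCommutativeRing R) fromℤ-homomorphism fromℤ-≟ public

suc[2*m]%2≡1 : ∀ m → suc (2 N.* m) N.% 2 ≡ 1
suc[2*m]%2≡1 zero = ≡.refl
suc[2*m]%2≡1 (suc m) rewrite N.+-suc m (m N.+ 0) = suc[2*m]%2≡1 m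

suc[2*m+1]%2≡0 : ∀ m → suc (2 N.* m N.+ 1) N.% 2 ≡ 0
suc[2*m+1]%2≡0 zero = ≡.refl
suc[2*m+1]%2≡0 (suc m) rewrite N.+-suc m (m N.+ 0) = suc[2*m+1]%2≡0 m

open import Data.Product using (_×_; _,_; proj₁; proj₂; uncurry)

module _ {c ℓ} (F : Field c ℓ) where
  open Field F
  open IntegerCoefficients commutativeRing
  open import Algebra.Properties.Group +-group using () renaming (x≈y⇒x∙y⁻¹≈ε to x≈y⇒x-y≈0)
  open import Relation.Binary.Reasoning.Setoid setoid

  ① ② : ∀ {n} → Polynomial n
  ① = con (+ 1)
  ② = con (+ 2)

  u≈0⇒x+u*y≈x : ∀ {u x y} → u ≈ 0# → x + u * y ≈ x
  u≈0⇒x+u*y≈x {u} {x} {y} u≈0 = begin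
    x + u * y   ≈⟨ +-congˡ (*-congʳ u≈0) ⟩
    x + 0# * y  ≈⟨ +-congˡ (zeroˡ y) ⟩
    x + 0#      ≈⟨ +-identityʳ x ⟩
    x           ∎

  *-cancelˡ-≉0 : ∀ {d a b} → ¬ (d ≈ 0#) → d * a ≈ d * b → a ≈ b
  *-cancelˡ-≉0 {d} {a} {b} d≉0 da≈db = begin
    a                   ≈⟨ *-identityˡ a ⟨
    1# * a              ≈⟨ *-congʳ d⁻¹d≈1 ⟨
    (d ⁻¹ * d) * a      ≈⟨ *-assoc _ _ _ ⟩
    d ⁻¹ * (d * a)      ≈⟨ *-congˡ da≈db ⟩
    d ⁻¹ * (d * b)      ≈⟨ *-assoc _ _ _ ⟨
    (d ⁻¹ * d) * b      ≈⟨ *-congʳ d⁻¹d≈1 ⟩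
    1# * b              ≈⟨ *-identityˡ b ⟩
    b                   ∎
    where
    d⁻¹d≈1 : d ⁻¹ * d ≈ 1#
    d⁻¹d≈1 = trans (*-comm _ _) (*-inverse d d≉0)

  *-≉0 : ∀ {a b} → ¬ (a ≈ 0#) → ¬ (b ≈ 0#) → ¬ (a * b ≈ 0#)
  *-≉0 {a} a≉0 b≉0 ab≈0 = b≉0 (*-cancelˡ-≉0 a≉0 (trans ab≈0 (sym (zeroʳ a))))

  d*g≈n⇒g≈n/d : ∀ {d g n} → ¬ (d ≈ 0#) → d * g ≈ n → g ≈ n / d
  d*g≈n⇒g≈n/d {d} {g} {n} d≉0 dg≈n = begin
    g                 ≈⟨ *-identityʳ g ⟨
    g * 1#            ≈⟨ *-congˡ (*-inverse d d≉0) ⟨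
    g * (d * d ⁻¹)    ≈⟨ *-assoc _ _ _ ⟨
    (g * d) * d ⁻¹    ≈⟨ *-congʳ (trans (*-comm g d) dg≈n) ⟩
    n * d ⁻¹          ∎

  module _ (α β x : Carrier) where

    Gbar-even : ∀ m → Gbar α β x (2 N.* suc m) ≈ x * Gbar α β x (2 N.* m N.+ 1) - Gbar α β x (2 N.* m)
    Gbar-even m rewrite N.+-suc m (m N.+ 0) | N.+-comm (2 N.* m) 1 | suc[2*m]%2≡1 m =
      +-congʳ (*-congʳ (*-identityʳ x))

    Gbar-odd : ∀ m → Gbar α β x (2 N.* suc m N.+ 1) ≈ Gbar α β x (2 N.* suc m) - Gbar α β x (2 N.* m N.+ 1)
    Gbar-odd m rewrite N.+-suc m (m N.+ 0) | suc[2*m+1]%2≡0 m | N.+-comm (2 N.* m) 1 =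
      +-congʳ (*-identityˡ _)

  ^-homo-* : ∀ y m n → y ^ (m N.+ n) ≈ y ^ m * y ^ n
  ^-homo-* y zero    n = sym (*-identityˡ _)
  ^-homo-* y (suc m) n = trans (*-congˡ (^-homo-* y m n)) (sym (*-assoc _ _ _))

  ^-2*+ : ∀ y m k → y ^ (2 N.* m N.+ k) ≈ y ^ m * y ^ m * y ^ k
  ^-2*+ y m k = begin
    y ^ (2 N.* m N.+ k)              ≈⟨ ^-homo-* y (2 N.* m) k ⟩
    y ^ (m N.+ (m N.+ 0)) * y ^ k    ≈⟨ *-congʳ (^-homo-* y m (m N.+ 0)) ⟩
    y ^ m * y ^ (m N.+ 0) * y ^ k    ≡⟨ ≡.cong (λ n → y ^ m * y ^ n * y ^ k) (N.+-identityʳ m) ⟩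
    y ^ m * y ^ m * y ^ k            ∎

  ^-2* : ∀ y m → y ^ (2 N.* m) ≈ y ^ m * y ^ m
  ^-2* y m = trans (^-homo-* y m (m N.+ 0)) (reflexive (≡.cong (λ n → y ^ m * y ^ n) (N.+-identityʳ m)))

  module Binet (L M x : Carrier) (LM≈1 : L * M ≈ 1#) (x≈L+M+2 : x ≈ L + M + two) where

    LM-1≈0 : L * M - 1# ≈ 0#
    LM-1≈0 = x≈y⇒x-y≈0 LM≈1

    binet-step : ∀ {α β d a b} m → let G = Gbar α β x; P = L ^ m; Q = M ^ m in
                 d * G (2 N.* m) ≈ (L + 1#) * (a * P + b * Q) →
                 d * G (2 N.* m N.+ 1) ≈ a * (L * P) + b * Q →
                   d * G (2 N.* suc m) ≈ (L + 1#) * (a * (L * P) + b * (M * Q))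
                 × d * G (2 N.* suc m N.+ 1) ≈ a * (L * (L * P)) + b * (M * Q)
    binet-step {α} {β} {d} {a} {b} m dG₀ dG₁ = dG₂ , dG₃
      where
      G : ℕ → Carrier
      G = Gbar α β x
      P Q : Carrier
      P = L ^ m
      Q = M ^ m

      dG₂ : d * G (2 N.* suc m) ≈ (L + 1#) * (a * (L * P) + b * (M * Q))
      dG₂ = begin
        d * G (2 N.* suc m)
          ≈⟨ *-congˡ (Gbar-even α β x m) ⟩
        d * (x * G (2 N.* m N.+ 1) - G (2 N.* m))
          ≈⟨ solve 4 (λ d x g₁ g₀ → d :* (x :* g₁ :- g₀) := x :* (d :* g₁) :- d :* g₀) refl d x _ _ ⟩
        x * (d * G (2 N.* m N.+ 1)) - d * G (2 N.* m)
          ≈⟨ +-cong (*-cong x≈L+M+2 dG₁) (-‿cong dG₀) ⟩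
        (L + M + two) * (a * (L * P) + b * Q) - (L + 1#) * (a * P + b * Q)
          ≈⟨ solve 6 (λ L M a b P Q →
               (L :+ M :+ ②) :* (a :* (L :* P) :+ b :* Q) :- (L :+ ①) :* (a :* P :+ b :* Q)
               := (L :+ ①) :* (a :* (L :* P) :+ b :* (M :* Q)) :+ (L :* M :- ①) :* (a :* P :- b :* Q))
               refl L M a b P Q ⟩
        (L + 1#) * (a * (L * P) + b * (M * Q)) + (L * M - 1#) * (a * P - b * Q)
          ≈⟨ u≈0⇒x+u*y≈x LM-1≈0 ⟩
        (L + 1#) * (a * (L * P) + b * (M * Q)) ∎

      dG₃ : d * G (2 N.* suc m N.+ 1) ≈ a * (L * (L * P)) + b * (M * Q)
      dG₃ = begin
        d * G (2 N.* suc m N.+ 1)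
          ≈⟨ *-congˡ (Gbar-odd α β x m) ⟩
        d * (G (2 N.* suc m) - G (2 N.* m N.+ 1))
          ≈⟨ solve 3 (λ d g₂ g₁ → d :* (g₂ :- g₁) := d :* g₂ :- d :* g₁) refl d _ _ ⟩
        d * G (2 N.* suc m) - d * G (2 N.* m N.+ 1)
          ≈⟨ +-cong dG₂ (-‿cong dG₁) ⟩
        (L + 1#) * (a * (L * P) + b * (M * Q)) - (a * (L * P) + b * Q)
          ≈⟨ solve 6 (λ L M a b P Q →
               (L :+ ①) :* (a :* (L :* P) :+ b :* (M :* Q)) :- (a :* (L :* P) :+ b :* Q)
               := a :* (L :* (L :* P)) :+ b :* (M :* Q) :+ (L :* M :- ①) :* (b :* Q))
               refl L M a b P Q ⟩
        a * (L * (L * P)) + b * (M * Q) + (L * M - 1#) * (b * Q)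
          ≈⟨ u≈0⇒x+u*y≈x LM-1≈0 ⟩
        a * (L * (L * P)) + b * (M * Q) ∎

    binet : ∀ {α β d a b} → d * α ≈ (L + 1#) * (a + b) → d * β ≈ a * L + b → ∀ m →
              d * Gbar α β x (2 N.* m) ≈ (L + 1#) * (a * L ^ m + b * M ^ m)
            × d * Gbar α β x (2 N.* m N.+ 1) ≈ a * L ^ suc m + b * M ^ m
    binet {α} {β} {d} {a} {b} dα dβ zero = dG₀ , dG₁
      where
      dG₀ : d * α ≈ (L + 1#) * (a * 1# + b * 1#)
      dG₀ = trans dα (*-congˡ (+-cong (sym (*-identityʳ a)) (sym (*-identityʳ b))))
      dG₁ : d * β ≈ a * (L * 1#) + b * 1#
      dG₁ = trans dβ (+-cong (*-congˡ (sym (*-identityʳ L))) (sym (*-identityʳ b)))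
    binet dα dβ (suc m) = uncurry (binet-step m) (binet dα dβ m)

    fibonacci-binet : ∀ m → (L ^ 2 - 1#) * Gbar 1# 1# x (2 N.* m) ≈ (L + 1#) * (L * L ^ m + - 1# * M ^ m)
                          × (L ^ 2 - 1#) * Gbar 1# 1# x (2 N.* m N.+ 1) ≈ L * L ^ suc m + - 1# * M ^ m
    fibonacci-binet = binet
      (solve 1 (λ L → (L :* (L :* ①) :- ①) :* ① := (L :+ ①) :* (L :+ :- ①)) refl L)
      (solve 1 (λ L → (L :* (L :* ①) :- ①) :* ① := L :* L :+ :- ①) refl L)

    lucas-binet : ∀ m → (L + 1#) * Gbar two 1# x (2 N.* m) ≈ (L + 1#) * (1# * L ^ m + 1# * M ^ m)
                      × (L + 1#) * Gbar two 1# x (2 N.* m N.+ 1) ≈ 1# * L ^ suc m + 1# * M ^ m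
    lucas-binet = binet refl (solve 1 (λ L → (L :+ ①) :* ① := ① :* L :+ ①) refl L)

    ^-inverse : ∀ m → L ^ m * M ^ m ≈ 1#
    ^-inverse zero    = *-identityˡ 1#
    ^-inverse (suc m) = begin
      (L * L ^ m) * (M * M ^ m)  ≈⟨ solve 4 (λ L M P Q → (L :* P) :* (M :* Q) := (L :* M) :* (P :* Q)) refl L M _ _ ⟩
      (L * M) * (L ^ m * M ^ m)  ≈⟨ *-cong LM≈1 (^-inverse m) ⟩
      1# * 1#                    ≈⟨ *-identityˡ 1# ⟩
      1#                         ∎

    ^-≉0 : ∀ m → ¬ (L ^ m ≈ 0#)
    ^-≉0 m Lᵐ≈0 = 1≉0 (begin
      1#               ≈⟨ ^-inverse m ⟨
      L ^ m * M ^ m    ≈⟨ *-congʳ Lᵐ≈0 ⟩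
      0# * M ^ m       ≈⟨ zeroˡ _ ⟩
      0#               ∎)

    discriminant : x * x - four * x ≈ (L - M) * (L - M)
    discriminant = begin
      x * x - four * x
        ≈⟨ +-cong (*-cong x≈L+M+2 x≈L+M+2) (-‿cong (*-congˡ x≈L+M+2)) ⟩
      (L + M + two) * (L + M + two) - four * (L + M + two)
        ≈⟨ solve 2 (λ L M → (L :+ M :+ ②) :* (L :+ M :+ ②) :- (② :+ ②) :* (L :+ M :+ ②)
             := (L :- M) :* (L :- M) :+ (L :* M :- ①) :* (② :+ ②)) refl L M ⟩
      (L - M) * (L - M) + (L * M - 1#) * four
        ≈⟨ u≈0⇒x+u*y≈x LM-1≈0 ⟩
      (L - M) * (L - M) ∎

    module _ (disc≉0 : ¬ (x * x - four * x ≈ 0#)) where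

      L²-1≉0 : ¬ (L ^ 2 - 1# ≈ 0#)
      L²-1≉0 L²-1≈0 = disc≉0 (begin
        x * x - four * x    ≈⟨ discriminant ⟩
        (L - M) * (L - M)   ≈⟨ *-congʳ L-M≈0 ⟩
        0# * (L - M)        ≈⟨ zeroˡ _ ⟩
        0#                  ∎)
        where
        L-M≈0 : L - M ≈ 0#
        L-M≈0 = begin
          L - M
            ≈⟨ solve 2 (λ L M → L :- M
                 := con (+ 0) :+ (L :* (L :* ①) :- ①) :* M :+ (L :* M :- ①) :* (:- L)) refl L M ⟩
          0# + (L ^ 2 - 1#) * M + (L * M - 1#) * - L  ≈⟨ u≈0⇒x+u*y≈x LM-1≈0 ⟩
          0# + (L ^ 2 - 1#) * M                       ≈⟨ u≈0⇒x+u*y≈x L²-1≈0 ⟩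
          0#                                          ∎

      L²-1≈[L-1][L+1] : L ^ 2 - 1# ≈ (L - 1#) * (L + 1#)
      L²-1≈[L-1][L+1] = solve 1 (λ L → L :* (L :* ①) :- ① := (L :- ①) :* (L :+ ①)) refl L

      L-1≉0 : ¬ (L - 1# ≈ 0#)
      L-1≉0 L-1≈0 = L²-1≉0 (trans L²-1≈[L-1][L+1] (trans (*-congʳ L-1≈0) (zeroˡ _)))

      L+1≉0 : ¬ (L + 1# ≈ 0#)
      L+1≉0 L+1≈0 = L²-1≉0 (trans L²-1≈[L-1][L+1] (trans (*-congˡ L+1≈0) (zeroʳ _)))

      fibonacci-even : ∀ m → Gbar 1# 1# x (2 N.* m) ≈ (L ^ (2 N.* m N.+ 1) - 1#) / (L ^ m * (L - 1#))
      fibonacci-even m = d*g≈n⇒g≈n/d (*-≉0 (^-≉0 m) L-1≉0) (*-cancelˡ-≉0 L+1≉0 (begin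
        (L + 1#) * (P * (L - 1#) * G)
          ≈⟨ solve 3 (λ L P G → (L :+ ①) :* (P :* (L :- ①) :* G) := P :* ((L :* (L :* ①) :- ①) :* G)) refl L P G ⟩
        P * ((L ^ 2 - 1#) * G)
          ≈⟨ *-congˡ (proj₁ (fibonacci-binet m)) ⟩
        P * ((L + 1#) * (L * P + - 1# * Q))
          ≈⟨ solve 3 (λ L P Q → P :* ((L :+ ①) :* (L :* P :+ :- ① :* Q))
               := (L :+ ①) :* (P :* P :* (L :* ①) :- P :* Q)) refl L P Q ⟩
        (L + 1#) * (P * P * L ^ 1 - P * Q)
          ≈⟨ *-congˡ (+-cong (sym (^-2*+ L m 1)) (-‿cong (^-inverse m))) ⟩
        (L + 1#) * (L ^ (2 N.* m N.+ 1) - 1#) ∎))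
        where
        P Q G : Carrier
        P = L ^ m
        Q = M ^ m
        G = Gbar 1# 1# x (2 N.* m)

      fibonacci-odd : ∀ m → Gbar 1# 1# x (2 N.* m N.+ 1) ≈ (L ^ (2 N.* m N.+ 2) - 1#) / (L ^ m * (L ^ 2 - 1#))
      fibonacci-odd m = d*g≈n⇒g≈n/d (*-≉0 (^-≉0 m) L²-1≉0) (begin
        P * (L ^ 2 - 1#) * G                 ≈⟨ *-assoc _ _ _ ⟩
        P * ((L ^ 2 - 1#) * G)               ≈⟨ *-congˡ (proj₂ (fibonacci-binet m)) ⟩
        P * (L * (L * P) + - 1# * Q)
          ≈⟨ solve 3 (λ L P Q → P :* (L :* (L :* P) :+ :- ① :* Q) := P :* P :* (L :* (L :* ①)) :- P :* Q) refl L P Q ⟩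
        P * P * L ^ 2 - P * Q                ≈⟨ +-cong (sym (^-2*+ L m 2)) (-‿cong (^-inverse m)) ⟩
        L ^ (2 N.* m N.+ 2) - 1#             ∎)
        where
        P Q G : Carrier
        P = L ^ m
        Q = M ^ m
        G = Gbar 1# 1# x (2 N.* m N.+ 1)

      lucas-even : ∀ m → Gbar two 1# x (2 N.* m) ≈ (L ^ (2 N.* m) + 1#) / L ^ m
      lucas-even m = d*g≈n⇒g≈n/d (^-≉0 m) (*-cancelˡ-≉0 L+1≉0 (begin
        (L + 1#) * (P * G)                   ≈⟨ solve 3 (λ L P G → (L :+ ①) :* (P :* G) := P :* ((L :+ ①) :* G)) refl L P G ⟩
        P * ((L + 1#) * G)                   ≈⟨ *-congˡ (proj₁ (lucas-binet m)) ⟩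
        P * ((L + 1#) * (1# * P + 1# * Q))
          ≈⟨ solve 3 (λ L P Q → P :* ((L :+ ①) :* (① :* P :+ ① :* Q)) := (L :+ ①) :* (P :* P :+ P :* Q)) refl L P Q ⟩
        (L + 1#) * (P * P + P * Q)           ≈⟨ *-congˡ (+-cong (sym (^-2* L m)) (^-inverse m)) ⟩
        (L + 1#) * (L ^ (2 N.* m) + 1#)      ∎))
        where
        P Q G : Carrier
        P = L ^ m
        Q = M ^ m
        G = Gbar two 1# x (2 N.* m)

      lucas-odd : ∀ m → Gbar two 1# x (2 N.* m N.+ 1) ≈ (L ^ (2 N.* m N.+ 1) + 1#) / (L ^ m * (L + 1#))
      lucas-odd m = d*g≈n⇒g≈n/d (*-≉0 (^-≉0 m) L+1≉0) (begin
        P * (L + 1#) * G                     ≈⟨ *-assoc _ _ _ ⟩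
        P * ((L + 1#) * G)                   ≈⟨ *-congˡ (proj₂ (lucas-binet m)) ⟩
        P * (1# * (L * P) + 1# * Q)
          ≈⟨ solve 3 (λ L P Q → P :* (① :* (L :* P) :+ ① :* Q) := P :* P :* (L :* ①) :+ P :* Q) refl L P Q ⟩
        P * P * L ^ 1 + P * Q                ≈⟨ +-cong (sym (^-2*+ L m 1)) (^-inverse m) ⟩
        L ^ (2 N.* m N.+ 1) + 1#             ∎)
        where
        P Q G : Carrier
        P = L ^ m
        Q = M ^ m
        G = Gbar two 1# x (2 N.* m N.+ 1)

  module QuadraticRoots (two≉0 : ¬ (two ≈ 0#)) (x s : Carrier) (s²≈disc : s * s ≈ x * x - four * x) where

    root⁺ root⁻ : Carrier
    root⁺ = (x - two + s) / two
    root⁻ = (x - two - s) / two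

    two·two⁻¹≈1 : two * two ⁻¹ ≈ 1#
    two·two⁻¹≈1 = *-inverse two two≉0

    roots-product : root⁺ * root⁻ ≈ 1#
    roots-product = begin
      root⁺ * root⁻
        ≈⟨ solve 3 (λ x s i → ((x :- ② :+ s) :* i) :* ((x :- ② :- s) :* i)
             := ((x :- ②) :* (x :- ②) :- s :* s) :* (i :* i)) refl x s (two ⁻¹) ⟩
      ((x - two) * (x - two) - s * s) * (two ⁻¹ * two ⁻¹)
        ≈⟨ *-congʳ (+-congˡ (-‿cong s²≈disc)) ⟩
      ((x - two) * (x - two) - (x * x - four * x)) * (two ⁻¹ * two ⁻¹)
        ≈⟨ solve 2 (λ x i → ((x :- ②) :* (x :- ②) :- (x :* x :- (② :+ ②) :* x)) :* (i :* i)
             := (② :* i) :* (② :* i)) refl x (two ⁻¹) ⟩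
      (two * two ⁻¹) * (two * two ⁻¹)
        ≈⟨ *-cong two·two⁻¹≈1 two·two⁻¹≈1 ⟩
      1# * 1#
        ≈⟨ *-identityˡ 1# ⟩
      1# ∎

    roots-sum : x ≈ root⁺ + root⁻ + two
    roots-sum = sym (begin
      root⁺ + root⁻ + two
        ≈⟨ solve 3 (λ x s i → (x :- ② :+ s) :* i :+ (x :- ② :- s) :* i :+ ②
             := (x :- ②) :* (② :* i) :+ ②) refl x s (two ⁻¹) ⟩
      (x - two) * (two * two ⁻¹) + two
        ≈⟨ +-congʳ (*-congˡ two·two⁻¹≈1) ⟩
      (x - two) * 1# + two
        ≈⟨ solve 1 (λ x → (x :- ②) :* ① :+ ② := x) refl x ⟩
      x ∎)

corollary3p2 : {c ℓ : Level} (F : Field c ℓ) →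
    let open Field F in
    ¬ (two ≈ 0#) →
    (x s : Carrier) →
    s * s ≈ x * x - four * x →
    ¬ (x * x - four * x ≈ 0#) →
    let λ₀ = (x - two + s) / two in
    (m : ℕ) →
      (Gbar 1# 1# x (2 N.* m) ≈ (λ₀ ^ (2 N.* m N.+ 1) - 1#) / ((λ₀ ^ m) * (λ₀ - 1#)))
      × (Gbar 1# 1# x (2 N.* m N.+ 1) ≈ (λ₀ ^ (2 N.* m N.+ 2) - 1#) / ((λ₀ ^ m) * (λ₀ ^ 2 - 1#)))
      × (Gbar two 1# x (2 N.* m) ≈ (λ₀ ^ (2 N.* m) + 1#) / (λ₀ ^ m))
      × (Gbar two 1# x (2 N.* m N.+ 1) ≈ (λ₀ ^ (2 N.* m N.+ 1) + 1#) / ((λ₀ ^ m) * (λ₀ + 1#)))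
corollary3p2 F two≉0 x s s²≈disc disc≉0 m =
  fibonacci-even disc≉0 m , fibonacci-odd disc≉0 m , lucas-even disc≉0 m , lucas-odd disc≉0 m
  where
  open QuadraticRoots F two≉0 x s s²≈disc
  open Binet F root⁺ root⁻ x roots-product roots-sum
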